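{- Let $x$ be a formula. Then $\mathbf{SAT}_{\mathbf{st}}(x)$ holds if and only if one can assign either true or false to each $a\in\mathcal{A}$ such that $x$, read as a propositional formula (with $\mathrm{T}$ read as true, $\neg$ as negation, $\mathbin{\triangleleft\wedge}$ as ordinary conjunction, and atoms as propositional letters), is true.
   Context: Fix a set $\mathcal{A}$ of atoms. Formulas: $x ::= \mathrm{T} \mid a \mid \neg x \mid x \mathbin{\triangleleft\wedge} x$ ($a\in\mathcal{A}$). A valuation algebra is a nonempty set $V$ with maps $/:\mathcal{A}\times V\to\{\mathrm{T},\mathrm{F}\}$ and $\bullet:\mathcal{A}\times V\to V$, extended to formulas by: $\mathrm{T}/H=\mathrm{T}$, $\mathrm{T}\bullet H=H$; $(\neg x)/H=\neg(x/H)$, $(\neg x)\bullet H=x\bullet H$; $(x\mathbin{\triangleleft\wedge}y)/H = y/(x\bullet H)$ if $x/H=\mathrm{T}$, else $\mathrm{F}$; $(x\mathbin{\triangleleft\wedge}y)\bullet H = y\bullet(x\bullet H)$ if $x/H=\mathrm{T}$, else $x\bullet H$. ($u\bullet v\bullet H$ means $u\bullet(v\bullet H)$.) $V$ is static if for all $a,b\in\mathcal{A}$, $H\in V$: $a/(a\bullet H)=a/H$, $a\bullet a\bullet H=a\bullet H$, $a/(b\bullet a\bullet H)=a/H$, $a\bullet b\bullet a\bullet H=b\bullet a\bullet H$, and $a/(b\bullet H)=a/H$. $\mathbf{st}$ is the collection of static valuation algebras; $\mathbf{SAT}_{\mathbf{st}}(x)$ means there exist a static $V$ and $H\in V$ with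 $x/H=\mathrm{T}$. -}

module Defs where

open import Data.Bool using (Bool; true; false; not; _∧_)
open import Data.Product using (Σ; ∃; _,_; _×_)
open import Relation.Binary.PropositionalEquality using (_≡_)

data Formula (A : Set) : Set where
  T    : Formula A
  atom : A → Formula A
  ¬'_  : Formula A → Formula A
  _◁∧_ : Formula A → Formula A → Formula A

-- Truth values {T, F} are rendered as Bool (true = T, false = F).

record ValuationAlgebra (A : Set) : Set₁ where
  field
    V       : Set
    inhabit : V
    _/ₐ_    : A → V → Bool
    _•ₐ_    : A → V → V

module _ {A : Set} (VA : ValuationAlgebra A) where
  open ValuationAlgebra VA

  reply : Formula A → V → Bool × V
  reply T          H = true , H
  reply (atom a)   H = (a /ₐ H) , (a •ₐ H)
  reply (¬' x)     H with reply x H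
  ... | b , H' = not b , H'
  reply (x ◁∧ y)   H with reply x H
  ... | true  , H' = reply y H'
  ... | false , H' = false , H'

  infix 5 _/_ _•_
  _/_ : Formula A → V → Bool
  x / H = Data.Product.proj₁ (reply x H)

  _•_ : Formula A → V → V
  x • H = Data.Product.proj₂ (reply x H)

  record IsStatic : Set where
    field
      st1 : ∀ (a : A) H → a /ₐ (a •ₐ H) ≡ a /ₐ H
      st2 : ∀ (a : A) H → a •ₐ (a •ₐ H) ≡ a •ₐ H
      st3 : ∀ (a b : A) H → a /ₐ (b •ₐ (a •ₐ H)) ≡ a /ₐ H
      st4 : ∀ (a b : A) H → a •ₐ (b •ₐ (a •ₐ H)) ≡ b •ₐ (a •ₐ H)
      st5 : ∀ (a b : A) H → a /ₐ (b •ₐ H) ≡ a /ₐ H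

SAT-st : {A : Set} → Formula A → Set₁
SAT-st {A} x =
  Σ (ValuationAlgebra A) λ VA →
    IsStatic VA × Σ (ValuationAlgebra.V VA) λ H → _/_ VA x H ≡ true

eval : {A : Set} → (A → Bool) → Formula A → Bool
eval σ T        = true
eval σ (atom a) = σ a
eval σ (¬' x)   = not (eval σ x)
eval σ (x ◁∧ y) = eval σ x ∧ eval σ y

PropSat : {A : Set} → Formula A → Set
PropSat {A} x = Σ (A → Bool) λ σ → eval σ x ≡ true

module Submission where

-- (⇒) Only the axiom  a / (b • H) = a / H  is needed: it makes the atom
--     readings at a state H invariant under the action of any formula, so
--     evaluating  x ◁∧ y  at H reads y at a state with the same atom readings
--     as H.  Hence  x / H  is the classical value of x under the assignment
--     a ↦ a / H  (lemma `reply-is-eval`), and that assignment witnesses PropSat.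
-- (⇐) An assignment σ gives the one-point valuation algebra reading each atom
--     a as σ a; it is trivially static, and by `reply-is-eval` its single
--     state satisfies x whenever σ does.

open import Defs
open import Function.Bundles using (_⇔_; mk⇔)
open import Data.Bool using (Bool; true; false; not; _∧_)
open import Data.Product using (_,_)
open import Data.Unit using (⊤; tt)
open import Relation.Binary.PropositionalEquality using (_≡_; refl; sym; trans; cong; cong₂)

eval-cong : {A : Set} {σ τ : A → Bool} → (∀ a → σ a ≡ τ a) →
            ∀ x → eval σ x ≡ eval τ x
eval-cong σ≗τ T        = refl
eval-cong σ≗τ (atom a) = σ≗τ a
eval-cong σ≗τ (¬' x)   = cong not (eval-cong σ≗τ x)
eval-cong σ≗τ (x ◁∧ y) = cong₂ _∧_ (eval-cong σ≗τ x) (eval-cong σ≗τ y)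

module InvariantReadings {A : Set} (VA : ValuationAlgebra A)
         (invariant : ∀ (a b : A) H →
            ValuationAlgebra._/ₐ_ VA a (ValuationAlgebra._•ₐ_ VA b H)
              ≡ ValuationAlgebra._/ₐ_ VA a H) where
  open ValuationAlgebra VA

  readings : V → A → Bool
  readings H a = a /ₐ H

  readings-preserved : ∀ x H a → a /ₐ (_•_ VA x H) ≡ a /ₐ H
  readings-preserved T        H a = refl
  readings-preserved (atom b) H a = invariant a b H
  readings-preserved (¬' x)   H a with reply VA x H | readings-preserved x H a
  ... | _ , _ | preserved = preserved
  readings-preserved (x ◁∧ y) H a with reply VA x H | readings-preserved x H a
  ... | true  , H' | preserved = trans (readings-preserved y H' a) preserved
  ... | false , _  | preserved = preserved

  reply-is-eval : ∀ x H → _/_ VA x H ≡ eval (readings H) x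
  reply-is-eval T        H = refl
  reply-is-eval (atom a) H = refl
  reply-is-eval (¬' x)   H with reply VA x H | reply-is-eval x H
  ... | _ , _ | x≡ = cong not x≡
  reply-is-eval (x ◁∧ y) H with reply VA x H | reply-is-eval x H | readings-preserved x H
  ... | true  , H' | x≡ | same = trans (reply-is-eval y H')
                                   (trans (eval-cong same y)
                                          (cong (_∧ eval (readings H) y) x≡))
  ... | false , _  | x≡ | _    = cong (_∧ eval (readings H) y) x≡

pointAlgebra : {A : Set} → (A → Bool) → ValuationAlgebra A
pointAlgebra σ = record { V = ⊤ ; inhabit = tt ; _/ₐ_ = λ a _ → σ a ; _•ₐ_ = λ _ _ → tt }

pointAlgebra-static : {A : Set} (σ : A → Bool) → IsStatic (pointAlgebra σ)
pointAlgebra-static σ = record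
  { st1 = λ _ _ → refl ; st2 = λ _ _ → refl ; st3 = λ _ _ _ → refl
  ; st4 = λ _ _ _ → refl ; st5 = λ _ _ _ → refl }

corollary3p15 : {A : Set} (x : Formula A) → SAT-st x ⇔ PropSat x
corollary3p15 x = mk⇔ sound complete
  where
  sound : SAT-st x → PropSat x
  sound (VA , static , H , x/H) =
    readings H , trans (sym (reply-is-eval x H)) x/H
    where open InvariantReadings VA (IsStatic.st5 static)

  complete : PropSat x → SAT-st x
  complete (σ , evalσx) =
    pointAlgebra σ , pointAlgebra-static σ , tt , trans (reply-is-eval x tt) evalσx
    where open InvariantReadings (pointAlgebra σ) (λ _ _ _ → refl)
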